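{- Let $d\ge2$ and let $\mathbf t$ be the $d$-bonacci word. For every $k\in\mathbb N$, the $k$-th bispecial factor $B_\mathbf t(k)$ of $\mathbf t$ has length $$|B_\mathbf t(k)|=\frac{1}{d-1}\sum_{i=0}^{d-1}(d-i)D_{k-i-1}-\frac{d}{d-1}.$$
   Context: The $d$-bonacci word $\mathbf t$ is the fixed point of the morphism $\tau$ on $\{0,\dots,d-1\}$ given by $\tau(a)=0(a+1)$ for $a=0,\dots,d-2$ and $\tau(d-1)=0$. The $d$-bonacci numbers are $D_k=2^k$ for $k=0,\dots,d-1$ and $D_k=\sum_{j=1}^d D_{k-j}$ for $k\ge d$, with the conventions $D_{ -1}=1$ and $D_{ -k}=0$ for $k=2,\dots,d$. A factor $w$ is bispecial if it is both left special ($aw,bw$ factors for distinct letters $a,b$) and right special ($wa,wb$ factors for distinct letters $a,b$); $\mathbf t$ has at most one bispecial factor of each length, and $B_\mathbf t(k)$ denotes the $k$-th one ordered by length, $B_\mathbf t(0)=\varepsilon$. -}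

module Defs where

open import Data.Nat using (ℕ; zero; suc; _+_; _*_; _∸_; _^_; _≤_; _<_; _<ᵇ_)
open import Data.Bool using (if_then_else_)
open import Data.Integer using (ℤ; +_; -[1+_])
import Data.Integer as ℤ
open import Data.List using (List; []; _∷_; _++_; length; concatMap; map; upTo; [_])
open import Data.Nat.ListAction using (sum)
open import Data.List.Membership.Propositional using (_∈_)
open import Data.List.Relation.Unary.All using (All)
open import Data.List.Relation.Unary.Linked using (Linked)
open import Data.Product using (Σ; _×_; ∃)
open import Relation.Binary.PropositionalEquality using (_≡_; _≢_)

-- Letters of the alphabet {0,…,d-1} are represented by natural numbers.

τ : ℕ → ℕ → List ℕ
τ d a = if suc a <ᵇ d then 0 ∷ suc a ∷ [] else 0 ∷ []

τ-iter : ℕ → ℕ → List ℕ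
τ-iter d zero    = 0 ∷ []
τ-iter d (suc m) = concatMap (τ d) (τ-iter d m)

-- n-th element of a list (with default 0 if out of range)
nth : List ℕ → ℕ → ℕ
nth []       _       = 0
nth (x ∷ xs) zero    = x
nth (x ∷ xs) (suc n) = nth xs n

-- The d-bonacci word t = lim τ^m(0), as an infinite word ℕ → letters.
-- Since |τ^(n+1)(0)| = D_(n+1) > n, the n-th letter is read off τ^(n+1)(0).
t : ℕ → ℕ → ℕ
t d n = nth (τ-iter d (suc n)) n

slice : ℕ → ℕ → ℕ → List ℕ
slice d i zero    = []
slice d i (suc n) = t d i ∷ slice d (suc i) n

Factor : ℕ → List ℕ → Set
Factor d w = Σ ℕ λ i → w ≡ slice d i (length w)

LeftSpecial : ℕ → List ℕ → Set
LeftSpecial d w = Σ ℕ λ a → Σ ℕ λ b → a ≢ b × Factor d (a ∷ w) × Factor d (b ∷ w)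

RightSpecial : ℕ → List ℕ → Set
RightSpecial d w = Σ ℕ λ a → Σ ℕ λ b → a ≢ b × Factor d (w ++ [ a ]) × Factor d (w ++ [ b ])

Bispecial : ℕ → List ℕ → Set
Bispecial d w = LeftSpecial d w × RightSpecial d w

BispecialLength : ℕ → ℕ → Set
BispecialLength d ℓ = ∃ λ w → Bispecial d w × length w ≡ ℓ

-- w is the k-th bispecial factor B_t(k) (ordered by length, B_t(0) = ε):
-- w is bispecial and there are exactly k lengths below |w| carrying a
-- bispecial factor (listed strictly increasingly in L).
IsKthBispecial : ℕ → ℕ → List ℕ → Set
IsKthBispecial d k w =
  Bispecial d w ×
  Σ (List ℕ) λ L →
    length L ≡ k ×
    Linked _<_ L ×
    All (λ ℓ → ℓ < length w × BispecialLength d ℓ) L ×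
    (∀ ℓ → ℓ < length w → BispecialLength d ℓ → ℓ ∈ L)

Dfuel : ℕ → ℕ → ℕ → ℕ
Dfuel d zero    n = 0
Dfuel d (suc f) n =
  if n <ᵇ d then 2 ^ n
  else sum (map (λ j → Dfuel d f (n ∸ suc j)) (upTo d))

Dℕ : ℕ → ℕ → ℕ
Dℕ d n = Dfuel d (suc n) n

-- D_k for integer indices: D_{-1} = 1, D_{-k} = 0 for k ≥ 2.
D : ℕ → ℤ → ℕ
D d (+ n)          = Dℕ d n
D d -[1+ zero ]    = 1
D d -[1+ suc _ ]   = 0

lenSum : ℕ → ℕ → ℕ
lenSum d k = sum (map (λ i → (d ∸ i) * D d ((+ k) ℤ.- (+ i) ℤ.- (+ 1))) (upTo d))

module Submission where

-- Let τʷ be τ extended to words, φ(v) = τʷ(v)0, and W₀ = ε, W_{k+1} = φ(W_k).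
--  * Arithmetic (Bonacci, RightHandSide).  Σ_{i<d} D_{k-i-1} = D_k for every
--    k ≥ 0, thanks to the conventions for negative indices; hence S_0 = d and
--    S_{k+1} = S_k + (d-1) D_k, and length-formula solves this recurrence.
--  * Synchronisation (Morphism, Blocks).  t = τʷ(t) is cut into blocks τ(t_n);
--    the 0s of t are exactly the block starts and τʷ is injective, so a factor
--    starting and ending with 0 is φ(v) for a unique factor v.
--  * Classification (Bispecials).  φ maps bispecial factors to bispecial
--    factors (extensions a, b become cyc a, cyc b, where cyc c = c+1 mod d);
--    conversely a nonempty bispecial factor starts and ends with 0 and is φ(v)
--    with v bispecial.  So the bispecial factors are exactly the W_k.
--  * Lengths (Lengths, Counting).  W_{k+1} = τ^k(0) W_k and |τ^k(0)| = D_k, so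
--    |W_{k+1}| = |W_k| + D_k; in particular the |W_k| increase, B_t(k) = W_k,
--    and the formula follows from length-formula.

open import Defs
open import Data.Nat using (ℕ; zero; suc; _+_; _*_; _∸_; _^_; _≤_; _<_; _<ᵇ_; z≤n; s≤s; z<s; _≟_; _<?_)
open import Data.Nat.Properties
open import Data.Bool using (true; false; if_then_else_)
open import Data.List using (List; concatMap; []; _∷_; _++_; length; map; upTo; applyUpTo; take; drop)
open import Data.List.Properties using (concatMap-++; length-applyUpTo; map-upTo; ++-identityʳ; length-++; ∷-injective; ∷-injectiveˡ; ∷-injectiveʳ; ++-assoc; ∷ʳ-injective)
open import Data.Nat.ListAction using (sum)
open import Data.Nat.Solver using (module +-*-Solver)
open import Data.List.Relation.Unary.All using (All; []; _∷_) renaming (lookup to lookupAll)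
open import Data.List.Relation.Unary.All.Properties using (++⁺; applyUpTo⁺₁)
open import Data.List.Relation.Unary.Linked using (Linked; _∷_; tail)
open import Data.List.Relation.Unary.Linked.Properties using (applyUpTo⁺₂)
open import Data.List.Membership.Propositional using (_∈_)
open import Data.List.Membership.Propositional.Properties using (∈-applyUpTo⁺; ∈-applyUpTo⁻)
open import Data.List.Relation.Unary.Any using (here; there)
open import Data.Integer using (-_) renaming (+_ to ⁺)
import Data.Integer as ℤ
open import Data.Integer.Properties using (pos-+)
open import Data.Product using (Σ; _×_; ∃; _,_; proj₁; proj₂)
open import Data.Sum using (inj₁; inj₂)
open import Relation.Nullary using (¬_; yes; no; contradiction)
open import Relation.Nullary.Reflects using (ofʸ; ofⁿ)
open import Relation.Binary.PropositionalEquality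

σ : (ℕ → ℕ) → ℕ → ℕ
σ f zero    = 0
σ f (suc n) = f 0 + σ (λ i → f (suc i)) n

sum-map-upTo : ∀ f n → sum (map f (upTo n)) ≡ σ f n
sum-map-upTo f n = trans (cong sum (map-upTo f n)) (sum-applyUpTo f n)
  where
  sum-applyUpTo : ∀ f n → sum (applyUpTo f n) ≡ σ f n
  sum-applyUpTo f zero    = refl
  sum-applyUpTo f (suc n) = cong (f 0 +_) (sum-applyUpTo (λ i → f (suc i)) n)

σ-cong : ∀ f h n → (∀ i → i < n → f i ≡ h i) → σ f n ≡ σ h n
σ-cong f h zero    _ = refl
σ-cong f h (suc n) e =
  cong₂ _+_ (e 0 z<s) (σ-cong (λ i → f (suc i)) (λ i → h (suc i)) n (λ i i<n → e (suc i) (s≤s i<n)))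

σ-zero : ∀ f n → (∀ i → i < n → f i ≡ 0) → σ f n ≡ 0
σ-zero f zero    _ = refl
σ-zero f (suc n) e = cong₂ _+_ (e 0 z<s) (σ-zero (λ i → f (suc i)) n (λ i i<n → e (suc i) (s≤s i<n)))

σ-split : ∀ f a b → σ f (a + b) ≡ σ f a + σ (λ i → f (a + i)) b
σ-split f zero    b = refl
σ-split f (suc a) b = trans (cong (f 0 +_) (σ-split (λ i → f (suc i)) a b)) (sym (+-assoc (f 0) _ _))

σ-snoc : ∀ f n → σ f (suc n) ≡ σ f n + f n
σ-snoc f n = begin
  σ f (suc n)                ≡⟨ cong (σ f) (+-comm 1 n) ⟩
  σ f (n + 1)                ≡⟨ σ-split f n 1 ⟩
  σ f n + (f (n + 0) + 0)    ≡⟨ cong (λ x → σ f n + x) (trans (+-identityʳ _) (cong f (+-identityʳ n))) ⟩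
  σ f n + f n                ∎
  where open ≡-Reasoning

σ-+ : ∀ f h n → σ (λ i → f i + h i) n ≡ σ f n + σ h n
σ-+ f h zero    = refl
σ-+ f h (suc n) = trans (cong (f 0 + h 0 +_) (σ-+ (λ i → f (suc i)) (λ i → h (suc i)) n))
                        (+-*-Solver.solve 4 (λ a b c e → a :+ b :+ (c :+ e) := a :+ c :+ (b :+ e)) refl
                           (f 0) (h 0) (σ (λ i → f (suc i)) n) (σ (λ i → h (suc i)) n))
  where open +-*-Solver using (_:+_; _:=_)

module StrictlyIncreasing (f : ℕ → ℕ) (step : ∀ i → f i < f (suc i)) where

  monotone : ∀ {m n} → m < n → f m < f n
  monotone {m} {suc n} m<1+n with m<1+n⇒m<n∨m≡n m<1+n
  ... | inj₁ m<n  = <-trans (monotone m<n) (step n)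
  ... | inj₂ refl = step n

  reflect-≤ : ∀ {m n} → f m ≤ f n → m ≤ n
  reflect-≤ fm≤fn = ≮⇒≥ (λ n<m → <⇒≱ (monotone n<m) fm≤fn)

  reflect-< : ∀ {m n} → f m < f n → m < n
  reflect-< {m} {n} fm<fn with m≤n⇒m<n∨m≡n (reflect-≤ (<⇒≤ fm<fn))
  ... | inj₁ m<n  = m<n
  ... | inj₂ refl = contradiction fm<fn (<-irrefl refl)

  injective : ∀ {m n} → f m ≡ f n → m ≡ n
  injective eq = ≤-antisym (reflect-≤ (≤-reflexive eq)) (reflect-≤ (≤-reflexive (sym eq)))

sorted-≡ : ∀ (xs ys : List ℕ) → Linked _<_ xs → Linked _<_ ys →
           (∀ z → z ∈ xs → z ∈ ys) → (∀ z → z ∈ ys → z ∈ xs) → xs ≡ ys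
sorted-≡ []       []       _   _   _    _    = refl
sorted-≡ []       (y ∷ ys) _   _   _    ys⊆ with ys⊆ y (here refl)
... | ()
sorted-≡ (x ∷ xs) []       _   _   xs⊆  _    with xs⊆ x (here refl)
... | ()
sorted-≡ (x ∷ xs) (y ∷ ys) ↗xs ↗ys xs⊆ ys⊆ =
  cong₂ _∷_ x≡y (sorted-≡ xs ys (tail ↗xs) (tail ↗ys) tail⊆ tail⊇)
  where
  below : ∀ {v vs z} → Linked _<_ (v ∷ vs) → z ∈ vs → v < z
  below (v<w ∷ _)   (here refl) = v<w
  below (v<w ∷ ↗ws) (there z∈)  = <-trans v<w (below ↗ws z∈)

  x≡y : x ≡ y
  x≡y with xs⊆ x (here refl) | ys⊆ y (here refl)
  ... | here x≡y  | _         = x≡y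
  ... | there _   | here y≡x  = sym y≡x
  ... | there x∈  | there y∈  = contradiction (below ↗ys x∈) (<-asym (below ↗xs y∈))

  tail⊆ : ∀ z → z ∈ xs → z ∈ ys
  tail⊆ z z∈ with xs⊆ z (there z∈)
  ... | here z≡y = contradiction (trans x≡y (sym z≡y)) (<⇒≢ (below ↗xs z∈))
  ... | there z∈' = z∈'

  tail⊇ : ∀ z → z ∈ ys → z ∈ xs
  tail⊇ z z∈ with ys⊆ z (there z∈)
  ... | here z≡x = contradiction (trans (sym x≡y) (sym z≡x)) (<⇒≢ (below ↗ys z∈))
  ... | there z∈' = z∈'

nth-++ˡ : ∀ (u v : List ℕ) i → i < length u → nth (u ++ v) i ≡ nth u i
nth-++ˡ (x ∷ u) v zero    _         = refl
nth-++ˡ (x ∷ u) v (suc i) (s≤s i<u) = nth-++ˡ u v i i<u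

nth-++ʳ : ∀ (u v : List ℕ) i → nth (u ++ v) (length u + i) ≡ nth v i
nth-++ʳ []      v i = refl
nth-++ʳ (x ∷ u) v i = nth-++ʳ u v i

module IndexArithmetic where
  import Data.Integer.Solver as ℤ-Solver
  open ℤ-Solver.+-*-Solver using (solve; _:+_; _:-_; :-_; con; _:=_)

  shift-index : ∀ k i → ⁺ (suc k) ℤ.- ⁺ (suc i) ℤ.- ⁺ 1 ≡ ⁺ k ℤ.- ⁺ i ℤ.- ⁺ 1
  shift-index k i = trans (cong₂ (λ a b → a ℤ.- b ℤ.- ⁺ 1) (pos-+ 1 k) (pos-+ 1 i))
    (solve 2 (λ K I → ((con (⁺ 1) :+ K) :- (con (⁺ 1) :+ I)) :- con (⁺ 1) := (K :- I) :- con (⁺ 1)) refl (⁺ k) (⁺ i))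

  nonneg-index : ∀ c i → ⁺ (suc i + c) ℤ.- ⁺ i ℤ.- ⁺ 1 ≡ ⁺ c
  nonneg-index c i = trans (cong (λ a → a ℤ.- ⁺ i ℤ.- ⁺ 1) (trans (pos-+ 1 (i + c)) (cong (ℤ._+_ (⁺ 1)) (pos-+ i c))))
    (solve 2 (λ C I → ((con (⁺ 1) :+ (I :+ C)) :- I) :- con (⁺ 1) := C) refl (⁺ c) (⁺ i))

  neg-index : ∀ k i → ⁺ k ℤ.- ⁺ (suc k + i) ℤ.- ⁺ 1 ≡ - ⁺ (suc (suc i))
  neg-index k i = trans (cong (λ a → ⁺ k ℤ.- a ℤ.- ⁺ 1) (trans (pos-+ 1 (k + i)) (cong (ℤ._+_ (⁺ 1)) (pos-+ k i))))
    (trans (solve 2 (λ K I → (K :- (con (⁺ 1) :+ (K :+ I))) :- con (⁺ 1) := :- (con (⁺ 2) :+ I)) refl (⁺ k) (⁺ i))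
           (cong -_ (sym (pos-+ 2 i))))

module Bonacci (d : ℕ) (0<d : 0 < d) where
  open IndexArithmetic

  private
    Dfuel-below : ∀ f n → n < d → Dfuel d (suc f) n ≡ 2 ^ n
    Dfuel-below f n n<d with n <ᵇ d | <ᵇ-reflects-< n d
    ... | true  | _       = refl
    ... | false | ofⁿ n≮d = contradiction n<d n≮d

    Dfuel-above : ∀ f n → ¬ n < d → Dfuel d (suc f) n ≡ σ (λ j → Dfuel d f (n ∸ suc j)) d
    Dfuel-above f n n≮d with n <ᵇ d | <ᵇ-reflects-< n d
    ... | true  | ofʸ n<d = contradiction n<d n≮d
    ... | false | _       = sum-map-upTo (λ j → Dfuel d f (n ∸ suc j)) d

    earlier : ∀ n j → ¬ n < d → n ∸ suc j < n
    earlier zero    j n≮d = contradiction 0<d n≮d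
    earlier (suc n) j _   = s≤s (m∸n≤m n j)

    fuel-irrelevant : ∀ f f' n → n < f → n < f' → Dfuel d f n ≡ Dfuel d f' n
    fuel-irrelevant (suc f) (suc f') n (s≤s n<f) (s≤s n<f') with n <? d
    ... | yes n<d = trans (Dfuel-below f n n<d) (sym (Dfuel-below f' n n<d))
    ... | no  n≮d = trans (Dfuel-above f n n≮d)
        (trans (σ-cong _ _ d (λ j _ → fuel-irrelevant f f' (n ∸ suc j)
                                        (<-≤-trans (earlier n j n≮d) n<f) (<-≤-trans (earlier n j n≮d) n<f')))
               (sym (Dfuel-above f' n n≮d)))

  D-below : ∀ n → n < d → Dℕ d n ≡ 2 ^ n
  D-below n = Dfuel-below n n

  D-above : ∀ n → ¬ n < d → Dℕ d n ≡ σ (λ j → Dℕ d (n ∸ suc j)) d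
  D-above n n≮d = trans (Dfuel-above n n n≮d)
    (σ-cong _ _ d (λ j _ → fuel-irrelevant n (suc (n ∸ suc j)) (n ∸ suc j) (earlier n j n≮d) ≤-refl))

  Dshift : ℕ → ℕ → ℕ
  Dshift k i = D d (⁺ k ℤ.- ⁺ i ℤ.- ⁺ 1)

  Dshift-suc : ∀ k i → Dshift (suc k) (suc i) ≡ Dshift k i
  Dshift-suc k i = cong (D d) (shift-index k i)

  Dshift-nonneg : ∀ c i → Dshift (suc i + c) i ≡ Dℕ d c
  Dshift-nonneg c i = cong (D d) (nonneg-index c i)

  Dshift-0 : ∀ k → Dshift (suc k) 0 ≡ Dℕ d k
  Dshift-0 k = Dshift-nonneg k 0

  Dshift-neg : ∀ k i → Dshift k (suc k + i) ≡ 0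
  Dshift-neg k i = cong (D d) (neg-index k i)

  -- For k < d: D_{k-1} + … + D_0 + D_{-1} = 2^{k-1} + … + 1 + 1 = 2^k.
  bonacci-sum-small : ∀ k → k < d → σ (Dshift k) (suc k) ≡ 2 ^ k
  bonacci-sum-small zero    _      = refl
  bonacci-sum-small (suc k) 1+k<d = begin
    Dshift (suc k) 0 + σ (λ i → Dshift (suc k) (suc i)) (suc k)
      ≡⟨ cong₂ _+_ (Dshift-0 k) (σ-cong _ _ (suc k) (λ i _ → Dshift-suc k i)) ⟩
    Dℕ d k + σ (Dshift k) (suc k)
      ≡⟨ cong₂ _+_ (D-below k k<d) (bonacci-sum-small k k<d) ⟩
    2 ^ k + 2 ^ k
      ≡⟨ cong (2 ^ k +_) (sym (+-identityʳ (2 ^ k))) ⟩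
    2 ^ suc k ∎
    where
    open ≡-Reasoning
    k<d : k < d
    k<d = <-trans (n<1+n k) 1+k<d

  bonacci-sum : ∀ k → σ (Dshift k) d ≡ Dℕ d k
  bonacci-sum k with k <? d
  ... | yes k<d = begin
    σ (Dshift k) d                                  ≡⟨ cong (σ (Dshift k)) (sym (m+[n∸m]≡n k<d)) ⟩
    σ (Dshift k) (suc k + (d ∸ suc k))              ≡⟨ σ-split (Dshift k) (suc k) (d ∸ suc k) ⟩
    σ (Dshift k) (suc k) + σ (λ i → Dshift k (suc k + i)) (d ∸ suc k)
      ≡⟨ cong₂ _+_ (bonacci-sum-small k k<d) (σ-zero _ (d ∸ suc k) (λ i _ → Dshift-neg k i)) ⟩
    2 ^ k + 0                                       ≡⟨ +-identityʳ _ ⟩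
    2 ^ k                                           ≡⟨ sym (D-below k k<d) ⟩
    Dℕ d k                                          ∎
    where open ≡-Reasoning
  ... | no k≮d = trans
    (σ-cong _ _ d (λ i i<d → trans (cong (λ m → Dshift m i) (sym (m+[n∸m]≡n (≤-trans i<d (≮⇒≥ k≮d)))))
                                   (Dshift-nonneg (k ∸ suc i) i)))
    (sym (D-above k k≮d))

module RightHandSide (n : ℕ) where
  open Bonacci (suc n) z<s
  open +-*-Solver using (solve; _:+_; _:*_; con; _:=_)

  -- Σ_{i<n} (n-i) D_{k-i-1}: the part shared by S_k and S_{k+1}.
  shared : ℕ → ℕ
  shared k = σ (λ i → (n ∸ i) * Dshift k i) n

  lenSum-σ : ∀ k → lenSum (suc n) k ≡ σ (λ i → (suc n ∸ i) * Dshift k i) (suc n)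
  lenSum-σ k = sum-map-upTo (λ i → (suc n ∸ i) * Dshift k i) (suc n)

  lenSum-via-shared : ∀ k → lenSum (suc n) k ≡ shared k + Dℕ (suc n) k
  lenSum-via-shared k = begin
    lenSum (suc n) k
      ≡⟨ lenSum-σ k ⟩
    σ (λ i → (suc n ∸ i) * Dshift k i) (suc n)
      ≡⟨ σ-cong _ _ (suc n) (λ i i<1+n → peel-weight i (Dshift k i) (≤-pred i<1+n)) ⟩
    σ (λ i → (n ∸ i) * Dshift k i + Dshift k i) (suc n)
      ≡⟨ σ-+ (λ i → (n ∸ i) * Dshift k i) (Dshift k) (suc n) ⟩
    σ (λ i → (n ∸ i) * Dshift k i) (suc n) + σ (Dshift k) (suc n)
      ≡⟨ cong₂ _+_ (σ-snoc _ n) (bonacci-sum k) ⟩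
    shared k + (n ∸ n) * Dshift k n + Dℕ (suc n) k
      ≡⟨ cong (λ m → shared k + m * Dshift k n + Dℕ (suc n) k) (n∸n≡0 n) ⟩
    shared k + 0 + Dℕ (suc n) k
      ≡⟨ cong (_+ Dℕ (suc n) k) (+-identityʳ (shared k)) ⟩
    shared k + Dℕ (suc n) k ∎
    where
    open ≡-Reasoning
    peel-weight : ∀ i x → i ≤ n → (suc n ∸ i) * x ≡ (n ∸ i) * x + x
    peel-weight i x i≤n = trans (cong (_* x) (+-∸-assoc 1 i≤n)) (+-comm x ((n ∸ i) * x))

  lenSum-suc-via-shared : ∀ k → lenSum (suc n) (suc k) ≡ suc n * Dℕ (suc n) k + shared k
  lenSum-suc-via-shared k = trans (lenSum-σ (suc k))
    (cong₂ (λ a b → suc n * a + b) (Dshift-0 k) (σ-cong _ _ n (λ i _ → cong ((n ∸ i) *_) (Dshift-suc k i))))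

  lenSum-zero : lenSum (suc n) 0 ≡ suc n
  lenSum-zero = trans (lenSum-σ 0) (trans
    (cong₂ _+_ (*-identityʳ (suc n)) (σ-zero _ n (λ i _ → trans (cong ((n ∸ i) *_) (Dshift-neg 0 i)) (*-zeroʳ (n ∸ i)))))
    (+-identityʳ (suc n)))

  lenSum-suc : ∀ k → lenSum (suc n) (suc k) ≡ lenSum (suc n) k + n * Dℕ (suc n) k
  lenSum-suc k = begin
    lenSum (suc n) (suc k)        ≡⟨ lenSum-suc-via-shared k ⟩
    suc n * Dk + shared k         ≡⟨ solve 3 (λ n D A → (con 1 :+ n) :* D :+ A := A :+ D :+ n :* D) refl n Dk (shared k) ⟩
    shared k + Dk + n * Dk        ≡⟨ cong (_+ n * Dk) (sym (lenSum-via-shared k)) ⟩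
    lenSum (suc n) k + n * Dk     ∎
    where
    open ≡-Reasoning
    Dk = Dℕ (suc n) k

length-formula : ∀ d → 0 < d → (l : ℕ → ℕ) → l 0 ≡ 0 → (∀ k → l (suc k) ≡ Dℕ d k + l k) →
                 ∀ k → (d ∸ 1) * l k + d ≡ lenSum d k
length-formula (suc n) _ l l0 lsuc zero = begin
  n * l 0 + suc n   ≡⟨ cong (λ x → n * x + suc n) l0 ⟩
  n * 0 + suc n     ≡⟨ cong (_+ suc n) (*-zeroʳ n) ⟩
  suc n             ≡⟨ sym lenSum-zero ⟩
  lenSum (suc n) 0  ∎
  where
  open ≡-Reasoning
  open RightHandSide n
length-formula (suc n) 0<d l l0 lsuc (suc k) = begin
  n * l (suc k) + suc n              ≡⟨ cong (λ x → n * x + suc n) (lsuc k) ⟩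
  n * (Dk + l k) + suc n
    ≡⟨ solve 3 (λ n D l → n :* (D :+ l) :+ (con 1 :+ n) := (n :* l :+ (con 1 :+ n)) :+ n :* D) refl n Dk (l k) ⟩
  (n * l k + suc n) + n * Dk         ≡⟨ cong (_+ n * Dk) (length-formula (suc n) 0<d l l0 lsuc k) ⟩
  lenSum (suc n) k + n * Dk          ≡⟨ sym (lenSum-suc k) ⟩
  lenSum (suc n) (suc k)             ∎
  where
  open ≡-Reasoning
  open RightHandSide n
  open +-*-Solver using (solve; _:+_; _:*_; con; _:=_)
  Dk = Dℕ (suc n) k

module Morphism (d : ℕ) (2≤d : 2 ≤ d) where

  0<d : 0 < d
  0<d = <-trans z<s 2≤d

  τʷ : List ℕ → List ℕ
  τʷ = concatMap (τ d)

  τʷ-++ : ∀ u v → τʷ (u ++ v) ≡ τʷ u ++ τʷ v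
  τʷ-++ = concatMap-++ (τ d)

  -- cyc c = c+1 mod d on letters; it is the letter following the initial 0 of
  -- the block τ(c) in t (the letter c+1, or the 0 of the next block).
  cyc : ℕ → ℕ
  cyc c = if suc c <ᵇ d then suc c else 0

  data Shape (c : ℕ) : Set where
    long  : suc c < d → τ d c ≡ 0 ∷ suc c ∷ [] → cyc c ≡ suc c → Shape c
    short : d ≤ suc c → τ d c ≡ 0 ∷ []        → cyc c ≡ 0     → Shape c

  shape : ∀ c → Shape c
  shape c with suc c <ᵇ d in eq | <ᵇ-reflects-< (suc c) d
  ... | true  | ofʸ c+1<d = long c+1<d (τ≡ eq) (cyc≡ eq)
    where τ≡ = cong (if_then 0 ∷ suc c ∷ [] else 0 ∷ []); cyc≡ = cong (if_then suc c else 0)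
  ... | false | ofⁿ c+1≮d = short (≮⇒≥ c+1≮d) (τ≡ eq) (cyc≡ eq)
    where τ≡ = cong (if_then 0 ∷ suc c ∷ [] else 0 ∷ []); cyc≡ = cong (if_then suc c else 0)

  τ-0 : τ d 0 ≡ 0 ∷ 1 ∷ []
  τ-0 with shape 0
  ... | long  _   eq _ = eq
  ... | short d≤1 _  _ = contradiction 2≤d (<⇒≱ (s≤s d≤1))

  cyc-0 : cyc 0 ≡ 1
  cyc-0 with shape 0
  ... | long  _   _ cyc≡ = cyc≡
  ... | short d≤1 _ _    = contradiction 2≤d (<⇒≱ (s≤s d≤1))

  τʷ-length : ∀ u → length u ≤ length (τʷ u)
  τʷ-length []      = z≤n
  τʷ-length (c ∷ u) with shape c
  ... | long  _ eq _ rewrite eq = m≤n⇒m≤1+n (s≤s (τʷ-length u))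
  ... | short _ eq _ rewrite eq = s≤s (τʷ-length u)

  Letters : List ℕ → Set
  Letters = All (_< d)

  τʷ-letters : ∀ u → Letters (τʷ u)
  τʷ-letters []      = []
  τʷ-letters (c ∷ u) = ++⁺ (τ-letters c) (τʷ-letters u)
    where
    τ-letters : ∀ c → Letters (τ d c)
    τ-letters c with shape c
    ... | long  c+1<d eq _ rewrite eq = 0<d ∷ c+1<d ∷ []
    ... | short _     eq _ rewrite eq = 0<d ∷ []

  P : ℕ → List ℕ
  P = τ-iter d

  P-extends : ∀ m → Σ (List ℕ) λ r → P (suc m) ≡ P m ++ r
  P-extends zero    = 1 ∷ [] , trans (++-identityʳ (τ d 0)) τ-0
  P-extends (suc m) with P-extends m
  ... | r , eq = τʷ r , trans (cong τʷ eq) (τʷ-++ (P m) r)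

  P-extends* : ∀ m j → Σ (List ℕ) λ r → P (j + m) ≡ P m ++ r
  P-extends* m zero    = [] , sym (++-identityʳ (P m))
  P-extends* m (suc j) with P-extends* m j | P-extends (j + m)
  ... | r , eq | r' , eq' = r ++ r' , trans eq' (trans (cong (_++ r') eq) (++-assoc (P m) r r'))

  P-starts-with-0 : ∀ m → Σ (List ℕ) λ r → P m ≡ 0 ∷ r
  P-starts-with-0 zero    = [] , refl
  P-starts-with-0 (suc m) with P-starts-with-0 m
  ... | r , eq rewrite eq | τ-0 = 1 ∷ τʷ r , refl

  P-length : ∀ m → m < length (P m)
  P-length zero    = z<s
  P-length (suc m) with P-starts-with-0 m | P-length m
  ... | r , eq | m<|Pm| rewrite eq | τ-0 = s≤s (≤-trans m<|Pm| (s≤s (τʷ-length r)))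

  P-letters : ∀ m → Letters (P m)
  P-letters zero    = 0<d ∷ []
  P-letters (suc m) = τʷ-letters (P m)

  P-nth-stable : ∀ m j n → n < length (P m) → nth (P (j + m)) n ≡ nth (P m) n
  P-nth-stable m j n n<|Pm| with P-extends* m j
  ... | r , eq = trans (cong (λ w → nth w n) eq) (nth-++ˡ (P m) r n n<|Pm|)

  t-from-P : ∀ m n → n < length (P m) → t d n ≡ nth (P m) n
  t-from-P m n n<|Pm| with ≤-total m (suc n)
  ... | inj₁ m≤1+n = trans (cong (λ i → nth (P i) n) (sym (m∸n+n≡m m≤1+n)))
                           (P-nth-stable m (suc n ∸ m) n n<|Pm|)
  ... | inj₂ 1+n≤m = sym (trans (cong (λ i → nth (P i) n) (sym (m∸n+n≡m 1+n≤m)))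
                                (P-nth-stable (suc n) (m ∸ suc n) n (<-trans (n<1+n n) (P-length (suc n)))))

  t-letter : ∀ n → t d n < d
  t-letter n = nth-letter (P (suc n)) n (P-letters (suc n)) (<-trans (n<1+n n) (P-length (suc n)))
    where
    nth-letter : ∀ xs n → Letters xs → n < length xs → nth xs n < d
    nth-letter (x ∷ xs) zero    (x<d ∷ _) _         = x<d
    nth-letter (x ∷ xs) (suc n) (_ ∷ ls)  (s≤s n<) = nth-letter xs n ls n<

  -- τ and cyc are injective on letters, and so is τʷ on words over them:
  -- blocks begin with their only 0, so τʷ u splits uniquely into blocks.
  top-letter : ∀ {c} → c < d → d ≤ suc c → suc c ≡ d
  top-letter c<d d≤1+c = ≤-antisym c<d d≤1+c

  cyc-injective : ∀ a b → a < d → b < d → cyc a ≡ cyc b → a ≡ b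
  cyc-injective a b a<d b<d eq with shape a | shape b
  ... | long  _   _ ca | long  _   _ cb = suc-injective (trans (sym ca) (trans eq cb))
  ... | long  _   _ ca | short _   _ cb = contradiction (trans (sym ca) (trans eq cb)) (λ ())
  ... | short _   _ ca | long  _   _ cb = contradiction (trans (sym cb) (trans (sym eq) ca)) (λ ())
  ... | short a≥  _ _  | short b≥  _ _  = suc-injective (trans (top-letter a<d a≥) (sym (top-letter b<d b≥)))

  τʷ-head : ∀ v {x r} → τʷ v ≡ x ∷ r → x ≡ 0
  τʷ-head (c ∷ v) eq with shape c
  ... | long  _ ec _ rewrite ec = sym (∷-injectiveˡ eq)
  ... | short _ ec _ rewrite ec = sym (∷-injectiveˡ eq)

  τʷ-injective : ∀ u v → Letters u → Letters v → τʷ u ≡ τʷ v → u ≡ v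
  τʷ-injective []      []      _ _ _  = refl
  τʷ-injective []      (b ∷ v) _ _ eq =
    contradiction (≤-trans (τʷ-length (b ∷ v)) (≤-reflexive (cong length (sym eq)))) (λ ())
  τʷ-injective (a ∷ u) []      _ _ eq =
    contradiction (≤-trans (τʷ-length (a ∷ u)) (≤-reflexive (cong length eq))) (λ ())
  τʷ-injective (a ∷ u) (b ∷ v) (a<d ∷ lu) (b<d ∷ lv) eq with shape a | shape b
  ... | long _ ea _ | long _ eb _ rewrite ea | eb =
        cong₂ _∷_ (suc-injective (∷-injectiveˡ (∷-injectiveʳ eq)))
                  (τʷ-injective u v lu lv (∷-injectiveʳ (∷-injectiveʳ eq)))
  ... | long _ ea _ | short _ eb _ rewrite ea | eb = contradiction (τʷ-head v (sym (∷-injectiveʳ eq))) (λ ())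
  ... | short _ ea _ | long _ eb _ rewrite ea | eb = contradiction (τʷ-head u (∷-injectiveʳ eq)) (λ ())
  ... | short a≥ ea _ | short b≥ eb _ rewrite ea | eb =
        cong₂ _∷_ (suc-injective (trans (top-letter a<d a≥) (sym (top-letter b<d b≥))))
                  (τʷ-injective u v lu lv (∷-injectiveʳ eq))

-- t = τʷ(t) is the concatenation of the blocks τ(t_n); block n starts at
-- position start n = |τʷ(t_0 … t_{n-1})|.  The 0s of t are exactly the block
-- starts, which lets us read off the block structure of any factor.
module Blocks (d : ℕ) (2≤d : 2 ≤ d) where
  open Morphism d 2≤d

  length-slice : ∀ s n → length (slice d s n) ≡ n
  length-slice s zero    = refl
  length-slice s (suc n) = cong suc (length-slice (suc s) n)

  slice-++ : ∀ s a b → slice d s (a + b) ≡ slice d s a ++ slice d (s + a) b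
  slice-++ s zero    b = cong (λ s → slice d s b) (sym (+-identityʳ s))
  slice-++ s (suc a) b = cong (t d s ∷_)
    (trans (slice-++ (suc s) a b) (cong (λ s' → slice d (suc s) a ++ slice d s' b) (sym (+-suc s a))))

  slice-∷ʳ : ∀ s n → slice d s (suc n) ≡ slice d s n ++ t d (s + n) ∷ []
  slice-∷ʳ s n = trans (cong (slice d s) (+-comm 1 n)) (slice-++ s n 1)

  slice-letters : ∀ s n → Letters (slice d s n)
  slice-letters s zero    = []
  slice-letters s (suc n) = t-letter s ∷ slice-letters (suc s) n

  take-slice : ∀ n (xs : List ℕ) s → n ≤ length xs → (∀ i → i < n → nth xs i ≡ t d (s + i)) →
               take n xs ≡ slice d s n
  take-slice zero    xs       s _         _     = refl
  take-slice (suc n) (x ∷ xs) s (s≤s n≤) agree =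
    cong₂ _∷_ (trans (agree 0 z<s) (cong (t d) (+-identityʳ s)))
              (take-slice n xs (suc s) n≤ (λ i i<n → trans (agree (suc i) (s≤s i<n)) (cong (t d) (+-suc s i))))

  start : ℕ → ℕ
  start n = length (τʷ (slice d 0 n))

  -- t begins with τʷ(t_0 … t_{n-1}) τ(t_n): apply τ to the prefix τ^{n+1}(0) = t_0 … t_n ….
  t-prefix : ∀ n → Σ (List ℕ) λ r → P (suc (suc n)) ≡ τʷ (slice d 0 n) ++ τ d (t d n) ++ r
  t-prefix n = τʷ (drop (suc n) xs) , (begin
    τʷ xs                                             ≡⟨ cong τʷ (split-at xs n n<xs) ⟩
    τʷ (take n xs ++ nth xs n ∷ drop (suc n) xs)      ≡⟨ τʷ-++ (take n xs) _ ⟩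
    τʷ (take n xs) ++ τ d (nth xs n) ++ τʷ (drop (suc n) xs)
      ≡⟨ cong₂ (λ u c → τʷ u ++ τ d c ++ τʷ (drop (suc n) xs)) prefix (sym (t-from-P (suc n) n n<xs)) ⟩
    τʷ (slice d 0 n) ++ τ d (t d n) ++ τʷ (drop (suc n) xs) ∎)
    where
    open ≡-Reasoning
    xs = P (suc n)
    n<xs : n < length xs
    n<xs = <-trans (n<1+n n) (P-length (suc n))
    prefix : take n xs ≡ slice d 0 n
    prefix = take-slice n xs 0 (<⇒≤ n<xs) (λ i i<n → sym (t-from-P (suc n) i (<-trans i<n n<xs)))
    split-at : ∀ (xs : List ℕ) n → n < length xs → xs ≡ take n xs ++ nth xs n ∷ drop (suc n) xs
    split-at (x ∷ xs) zero    _         = refl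
    split-at (x ∷ xs) (suc n) (s≤s n<) = cong (x ∷_) (split-at xs n n<)

  block-letter : ∀ n i → i < length (τ d (t d n)) → t d (start n + i) ≡ nth (τ d (t d n)) i
  block-letter n i i<block with t-prefix n
  ... | r , eq = begin
    t d (start n + i)                            ≡⟨ t-from-P (suc (suc n)) (start n + i) in-range ⟩
    nth (P (suc (suc n))) (start n + i)          ≡⟨ cong (λ w → nth w (start n + i)) eq ⟩
    nth (τʷ (slice d 0 n) ++ block ++ r) (start n + i) ≡⟨ nth-++ʳ (τʷ (slice d 0 n)) (block ++ r) i ⟩
    nth (block ++ r) i                           ≡⟨ nth-++ˡ block r i i<block ⟩
    nth block i                                  ∎
    where
    open ≡-Reasoning
    block = τ d (t d n)
    in-range : start n + i < length (P (suc (suc n)))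
    in-range = subst (start n + i <_)
      (sym (trans (cong length eq) (trans (length-++ (τʷ (slice d 0 n))) (cong (start n +_) (length-++ block)))))
      (+-monoʳ-< (start n) (≤-trans i<block (m≤m+n (length block) (length r))))

  start-via : ∀ n {b} → τ d (t d n) ≡ b → start (suc n) ≡ length b + start n
  start-via n {b} eq = begin
    length (τʷ (slice d 0 (suc n)))                ≡⟨ cong (λ u → length (τʷ u)) (slice-∷ʳ 0 n) ⟩
    length (τʷ (slice d 0 n ++ t d n ∷ []))        ≡⟨ cong length (τʷ-++ (slice d 0 n) (t d n ∷ [])) ⟩
    length (τʷ (slice d 0 n) ++ τ d (t d n) ++ []) ≡⟨ length-++ (τʷ (slice d 0 n)) ⟩
    start n + length (τ d (t d n) ++ [])           ≡⟨ cong (λ u → start n + length u) (trans (++-identityʳ _) eq) ⟩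
    start n + length b                             ≡⟨ +-comm (start n) (length b) ⟩
    length b + start n                             ∎
    where open ≡-Reasoning

  start-increasing : ∀ n → start n < start (suc n)
  start-increasing n with shape (t d n)
  ... | long  _ eq _ = subst (start n <_) (sym (start-via n eq)) (m<n⇒m<1+n (n<1+n (start n)))
  ... | short _ eq _ = subst (start n <_) (sym (start-via n eq)) (n<1+n (start n))

  open StrictlyIncreasing start start-increasing public using ()
    renaming (reflect-≤ to start-reflect-≤; injective to start-injective)

  t-at-start : ∀ n → t d (start n) ≡ 0
  t-at-start n with shape (t d n) | block-letter n 0
  ... | long  _ eq _ | letter rewrite eq = trans (cong (t d) (sym (+-identityʳ (start n)))) (letter z<s)
  ... | short _ eq _ | letter rewrite eq = trans (cong (t d) (sym (+-identityʳ (start n)))) (letter z<s)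

  t-second : ∀ n → τ d (t d n) ≡ 0 ∷ suc (t d n) ∷ [] → t d (suc (start n)) ≡ suc (t d n)
  t-second n eq = trans (cong (t d) (+-comm 1 (start n)))
                        (trans (block-letter n 1 (subst (λ b → 1 < length b) (sym eq) (s≤s (s≤s z≤n))))
                               (cong (λ b → nth b 1) eq))

  -- The letter after the start of block n is cyc t_n: the second letter of a
  -- long block, or the 0 starting block n+1.
  t-after-start : ∀ n → t d (suc (start n)) ≡ cyc (t d n)
  t-after-start n with shape (t d n)
  ... | long  _ eq cyc≡ = trans (t-second n eq) (sym cyc≡)
  ... | short _ eq cyc≡ = trans (cong (t d) (sym (start-via n eq))) (trans (t-at-start (suc n)) (sym cyc≡))

  data Position (m : ℕ) : Set where
    at-start : ∀ n → m ≡ start n → Position m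
    second   : ∀ n → m ≡ suc (start n) → τ d (t d n) ≡ 0 ∷ suc (t d n) ∷ [] → Position m

  position : ∀ m → Position m
  position zero = at-start 0 refl
  position (suc m) with position m
  ... | second n m≡ eq = at-start (suc n) (trans (cong suc m≡) (sym (start-via n eq)))
  ... | at-start n m≡ with shape (t d n)
  ...   | long  _ eq _ = second n (cong suc m≡) eq
  ...   | short _ eq _ = at-start (suc n) (trans (cong suc m≡) (sym (start-via n eq)))

  zero-at-start : ∀ m → t d m ≡ 0 → Σ ℕ λ n → m ≡ start n
  zero-at-start m tm≡0 with position m
  ... | at-start n m≡   = n , m≡
  ... | second n m≡ eq = contradiction (trans (sym (t-second n eq)) (trans (cong (t d) (sym m≡)) tm≡0)) (λ ())

  nonzero-preceded-by-0 : ∀ m → t d (suc m) ≢ 0 → t d m ≡ 0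
  nonzero-preceded-by-0 m t≢0 with position (suc m)
  ... | at-start n m≡  = contradiction (trans (cong (t d) m≡) (t-at-start n)) t≢0
  ... | second n m≡ _ = trans (cong (t d) (suc-injective m≡)) (t-at-start n)

  nonzero-followed-by-0 : ∀ m → t d m ≢ 0 → t d (suc m) ≡ 0
  nonzero-followed-by-0 m t≢0 with position m
  ... | at-start n m≡  = contradiction (trans (cong (t d) m≡) (t-at-start n)) t≢0
  ... | second n m≡ eq = trans (cong (t d) (trans (cong suc m≡) (sym (start-via n eq)))) (t-at-start (suc n))

  before-start : ∀ q n → suc q ≡ start n → Σ ℕ λ m → n ≡ suc m × t d q ≡ cyc (t d m)
  before-start q n q+1≡ with position q
  ... | second m q≡ eq with shape (t d m)
  ...   | short _ eq' _ = contradiction (trans (sym eq) eq') (λ ())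
  ...   | long  _ _ cyc≡ =
          m , start-injective (trans (sym q+1≡) (trans (cong suc q≡) (sym (start-via m eq)))) ,
          trans (cong (t d) q≡) (trans (t-second m eq) (sym cyc≡))
  before-start q n q+1≡ | at-start m q≡ with shape (t d m)
  ...   | long  _ eq _ = contradiction
          (trans (sym (t-second m eq)) (trans (cong (λ i → t d (suc i)) (sym q≡)) (trans (cong (t d) q+1≡) (t-at-start n))))
          (λ ())
  ...   | short _ eq cyc≡ =
          m , start-injective (trans (sym q+1≡) (trans (cong suc q≡) (sym (start-via m eq)))) ,
          trans (cong (t d) q≡) (trans (t-at-start m) (sym cyc≡))

  start-+ : ∀ n j → start (n + j) ≡ start n + length (τʷ (slice d n j))
  start-+ n zero    = trans (cong start (+-identityʳ n)) (sym (+-identityʳ (start n)))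
  start-+ n (suc j) = begin
    start (n + suc j)                                             ≡⟨ cong start (+-suc n j) ⟩
    start (suc n + j)                                             ≡⟨ start-+ (suc n) j ⟩
    start (suc n) + length rest                                   ≡⟨ cong (_+ length rest) (start-via n refl) ⟩
    length (τ d (t d n)) + start n + length rest                  ≡⟨ cong (_+ length rest) (+-comm _ (start n)) ⟩
    start n + length (τ d (t d n)) + length rest                  ≡⟨ +-assoc (start n) _ _ ⟩
    start n + (length (τ d (t d n)) + length rest)                ≡⟨ cong (start n +_) (sym (length-++ (τ d (t d n)))) ⟩
    start n + length (τʷ (slice d n (suc j)))                     ∎
    where
    open ≡-Reasoning
    rest = τʷ (slice d (suc n) j)

  block-decoding : ∀ n j → slice d (start n) (suc (length (τʷ (slice d n j)))) ≡ τʷ (slice d n j) ++ 0 ∷ []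
  block-decoding n zero    = cong (_∷ []) (t-at-start n)
  block-decoding n (suc j) with shape (t d n) | block-decoding (suc n) j
  ... | long  _ eq _ | ih rewrite eq = cong₂ _∷_ (t-at-start n) (cong₂ _∷_ (t-second n eq)
          (trans (cong (λ s → slice d s (suc (length (τʷ (slice d (suc n) j))))) (sym (start-via n eq))) ih))
  ... | short _ eq _ | ih rewrite eq = cong₂ _∷_ (t-at-start n)
          (trans (cong (λ s → slice d s (suc (length (τʷ (slice d (suc n) j))))) (sym (start-via n eq))) ih)

module Bispecials (d : ℕ) (2≤d : 2 ≤ d) where
  open Morphism d 2≤d
  open Blocks d 2≤d

  φ : List ℕ → List ℕ
  φ v = τʷ v ++ 0 ∷ []

  length-φ : ∀ v → length (φ v) ≡ suc (length (τʷ v))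
  length-φ v = trans (length-++ (τʷ v)) (+-comm (length (τʷ v)) 1)

  φ-injective : ∀ u v → Letters u → Letters v → φ u ≡ φ v → u ≡ v
  φ-injective u v lu lv eq = τʷ-injective u v lu lv (proj₁ (∷ʳ-injective (τʷ u) (τʷ v) eq))

  W : ℕ → List ℕ
  W zero    = []
  W (suc k) = φ (W k)

  occurrence-∷ʳ : ∀ v c → Factor d (v ++ c ∷ []) → Σ ℕ λ i → v ≡ slice d i (length v) × c ≡ t d (i + length v)
  occurrence-∷ʳ v c (i , eq) = i , ∷ʳ-injective v (slice d i (length v))
    (trans eq (trans (cong (slice d i) (trans (length-++ v) (+-comm (length v) 1))) (slice-∷ʳ i (length v))))

  first-letter : ∀ a v → Factor d (a ∷ v) → a < d
  first-letter a v (i , eq) = subst (_< d) (sym (∷-injectiveˡ eq)) (t-letter i)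

  last-letter : ∀ v c → Factor d (v ++ c ∷ []) → c < d
  last-letter v c f with occurrence-∷ʳ v c f
  ... | i , _ , c≡ = subst (_< d) (sym c≡) (t-letter (i + length v))

  occurs : ∀ w s → slice d s (length w) ≡ w → Factor d w
  occurs w s eq = s , sym eq

  φ-occurs : ∀ n j → slice d (start n) (length (φ (slice d n j))) ≡ φ (slice d n j)
  φ-occurs n j = trans (cong (slice d (start n)) (length-φ (slice d n j))) (block-decoding n j)

  -- If a v occurs at i, then φ(v) occurs at start (i+1), and the letter just
  -- before it is cyc a (the a+1 of a long block τ(a), or the 0 of a short one).
  φ-left : ∀ a v → Factor d (a ∷ v) → Factor d (cyc a ∷ φ v)
  φ-left a v (i , eq) with ∷-injective eq
  ... | refl , v≡ = subst (λ u → Factor d (cyc (t d i) ∷ φ u)) (sym v≡) (letter-before-block (shape (t d i)))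
    where
    rest = slice d (suc i) (length v)
    letter-before-block : Shape (t d i) → Factor d (cyc (t d i) ∷ φ rest)
    letter-before-block (long _ eq _) = occurs _ (suc (start i)) (cong₂ _∷_ (t-after-start i)
      (trans (cong (λ s → slice d s (length (φ rest))) (sym (start-via i eq))) (φ-occurs (suc i) (length v))))
    letter-before-block (short _ eq cyc≡) = occurs _ (start i) (cong₂ _∷_ (trans (t-at-start i) (sym cyc≡))
      (trans (cong (λ s → slice d s (length (φ rest))) (sym (start-via i eq))) (φ-occurs (suc i) (length v))))

  -- If v c occurs at i, then φ(v) occurs at start i and is followed by the
  -- second letter after the start of the block of c, i.e. by cyc c.
  φ-right : ∀ v c → Factor d (v ++ c ∷ []) → Factor d (φ v ++ cyc c ∷ [])
  φ-right v c f with occurrence-∷ʳ v c f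
  ... | i , v≡ , c≡ = subst₂ (λ x u → Factor d (φ u ++ cyc x ∷ [])) (sym c≡) (sym v≡) (occurs _ (start i) (begin
    slice d (start i) (length (φ u ++ x ∷ []))      ≡⟨ cong (slice d (start i)) (trans (length-++ (φ u)) (+-comm _ 1)) ⟩
    slice d (start i) (suc (length (φ u)))          ≡⟨ slice-∷ʳ (start i) (length (φ u)) ⟩
    slice d (start i) (length (φ u)) ++ t d (start i + length (φ u)) ∷ []
      ≡⟨ cong₂ (λ a b → a ++ b ∷ []) (φ-occurs i (length v)) next ⟩
    φ u ++ x ∷ []                                   ∎))
    where
    open ≡-Reasoning
    u = slice d i (length v)
    x = cyc (t d (i + length v))
    next : t d (start i + length (φ u)) ≡ x
    next = begin
      t d (start i + length (φ u))              ≡⟨ cong (λ m → t d (start i + m)) (length-φ u) ⟩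
      t d (start i + suc (length (τʷ u)))       ≡⟨ cong (t d) (+-suc (start i) (length (τʷ u))) ⟩
      t d (suc (start i + length (τʷ u)))       ≡⟨ cong (λ m → t d (suc m)) (sym (start-+ i (length v))) ⟩
      t d (suc (start (i + length v)))          ≡⟨ t-after-start (i + length v) ⟩
      x                                         ∎

  -- As cyc is injective, φ maps bispecial factors to bispecial factors.
  φ-bispecial : ∀ v → Bispecial d v → Bispecial d (φ v)
  φ-bispecial v ((a , b , a≢b , fa , fb) , (a' , b' , a'≢b' , fa' , fb')) =
    (cyc a , cyc b , (λ eq → a≢b (cyc-injective a b (first-letter a v fa) (first-letter b v fb) eq)) ,
      φ-left a v fa , φ-left b v fb) ,
    (cyc a' , cyc b' , (λ eq → a'≢b' (cyc-injective a' b' (last-letter v a' fa') (last-letter v b' fb') eq)) ,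
      φ-right v a' fa' , φ-right v b' fb')

  ε-bispecial : Bispecial d []
  ε-bispecial = (0 , 1 , (λ ()) , t0 , t1) , (0 , 1 , (λ ()) , t0 , t1)
    where
    t0 : Factor d (0 ∷ [])
    t0 = occurs _ 0 (cong (_∷ []) (t-at-start 0))
    t1 : Factor d (1 ∷ [])
    t1 = occurs _ 1 (cong (_∷ []) (trans (t-after-start 0) (trans (cong cyc (t-at-start 0)) cyc-0)))

  W-bispecial : ∀ k → Bispecial d (W k)
  W-bispecial zero    = ε-bispecial
  W-bispecial (suc k) = φ-bispecial (W k) (W-bispecial k)

  -- A nonempty bispecial factor starts with 0: a letter x ≠ 0 is always
  -- preceded by 0, so x w would have only one left extension.
  starts-with-0 : ∀ x w → Bispecial d (x ∷ w) → x ≡ 0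
  starts-with-0 x w ((a , b , a≢b , (qa , eqa) , (qb , eqb)) , _) with x ≟ 0
  ... | yes x≡0 = x≡0
  ... | no  x≢0 = contradiction (trans (preceded a qa eqa) (sym (preceded b qb eqb))) a≢b
    where
    preceded : ∀ c q → c ∷ x ∷ w ≡ slice d q (length (c ∷ x ∷ w)) → c ≡ 0
    preceded c q eq = trans (∷-injectiveˡ eq)
      (nonzero-preceded-by-0 q (λ t≡0 → x≢0 (trans (∷-injectiveˡ (∷-injectiveʳ eq)) t≡0)))

  -- Symmetrically it ends with 0, as a letter y ≠ 0 is always followed by 0.
  ends-with-0 : ∀ u y → Bispecial d (u ++ y ∷ []) → y ≡ 0
  ends-with-0 u y (_ , (a , b , a≢b , fa , fb)) with y ≟ 0
  ... | yes y≡0 = y≡0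
  ... | no  y≢0 = contradiction (trans (followed a fa) (sym (followed b fb))) a≢b
    where
    followed : ∀ c → Factor d ((u ++ y ∷ []) ++ c ∷ []) → c ≡ 0
    followed c f with occurrence-∷ʳ (u ++ y ∷ []) c f
    ... | i , uy≡ , c≡ = trans c≡ (trans
            (cong (t d) (trans (cong (i +_) (trans (length-++ u) (+-comm (length u) 1))) (+-suc i (length u))))
            (nonzero-followed-by-0 (i + length u) (λ t≡0 → y≢0 (trans y≡ t≡0))))
      where
      y≡ : y ≡ t d (i + length u)
      y≡ = proj₂ (proj₂ (occurrence-∷ʳ u y (i , uy≡)))

  -- A factor starting and ending with 0 is φ of a factor: both 0s are block starts.
  decode : ∀ s L → t d s ≡ 0 → t d (s + L) ≡ 0 →
           Σ ℕ λ n → Σ ℕ λ j → s ≡ start n × start (n + j) ≡ s + L × slice d s (suc L) ≡ φ (slice d n j)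
  decode s L ts≡0 tsL≡0 with zero-at-start s ts≡0 | zero-at-start (s + L) tsL≡0
  ... | n , s≡ | n' , sL≡ = n , n' ∸ n , s≡ , end≡ , (begin
    slice d s (suc L)                                  ≡⟨ cong₂ (λ a b → slice d a (suc b)) s≡ L≡ ⟩
    slice d (start n) (suc (length (τʷ (slice d n (n' ∸ n))))) ≡⟨ block-decoding n (n' ∸ n) ⟩
    φ (slice d n (n' ∸ n))                             ∎)
    where
    open ≡-Reasoning
    end≡ : start (n + (n' ∸ n)) ≡ s + L
    end≡ = trans (cong start (m+[n∸m]≡n (start-reflect-≤ {n} {n'} (subst₂ _≤_ s≡ sL≡ (m≤m+n s L))))) (sym sL≡)
    L≡ : L ≡ length (τʷ (slice d n (n' ∸ n)))
    L≡ = +-cancelˡ-≡ s L _ (trans (sym end≡) (trans (start-+ n (n' ∸ n)) (cong (_+ _) (sym s≡))))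

  -- Extensions of a nonempty bispecial factor w come from extensions of its
  -- φ-preimage: a w is a factor only as cyc b φ(v) with b v a factor, and
  -- likewise on the right.
  module Preimage (w : List ℕ) (L : ℕ) (|w|≡ : length w ≡ suc L) (bs : Bispecial d w) where

    decode-occurrence : ∀ s → w ≡ slice d s (length w) →
      Σ ℕ λ n → Σ ℕ λ j → s ≡ start n × start (n + j) ≡ s + L × w ≡ φ (slice d n j)
    decode-occurrence s occ =
      let n , j , s≡ , end≡ , w≡ = decode s L first last in n , j , s≡ , end≡ , trans occ' w≡
      where
      occ' : w ≡ slice d s (suc L)
      occ' = trans occ (cong (slice d s) |w|≡)
      first : t d s ≡ 0
      first = starts-with-0 (t d s) (slice d (suc s) L) (subst (Bispecial d) occ' bs)
      last : t d (s + L) ≡ 0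
      last = ends-with-0 (slice d s L) (t d (s + L)) (subst (Bispecial d) (trans occ' (slice-∷ʳ s L)) bs)

    LeftPreimage : ℕ → Set
    LeftPreimage a = Σ (List ℕ) λ v → Σ ℕ λ b → w ≡ φ v × Letters v × Factor d (b ∷ v) × a ≡ cyc b

    RightPreimage : ℕ → Set
    RightPreimage c = Σ (List ℕ) λ v → Σ ℕ λ b → w ≡ φ v × Letters v × Factor d (v ++ b ∷ []) × c ≡ cyc b

    left-preimage : ∀ a → Factor d (a ∷ w) → LeftPreimage a
    left-preimage a (q , eq) =
      let n , j , q+1≡ , _ , w≡ = decode-occurrence (suc q) (∷-injectiveʳ eq)
          m , n≡ , tq≡ = before-start q n q+1≡
      in slice d n j , t d m , w≡ , slice-letters n j ,
         occurs _ m (cong (t d m ∷_) (trans (cong (slice d (suc m)) (length-slice n j))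
                                             (cong (λ i → slice d i j) (sym n≡)))) ,
         trans (∷-injectiveˡ eq) tq≡

    right-preimage : ∀ c → Factor d (w ++ c ∷ []) → RightPreimage c
    right-preimage c f =
      let i , occ , c≡ = occurrence-∷ʳ w c f
          n , j , _ , end≡ , w≡ = decode-occurrence i occ
      in slice d n j , t d (n + j) , w≡ , slice-letters n j ,
         occurs _ n (trans (cong (slice d n) (trans (length-++ (slice d n j))
                                                   (trans (cong (_+ 1) (length-slice n j)) (+-comm j 1))))
                           (slice-∷ʳ n j)) ,
         trans c≡ (trans (cong (t d) (trans (cong (i +_) |w|≡) (trans (+-suc i L) (cong suc (sym end≡)))))
                         (t-after-start (n + j)))

    assemble : ∀ {a b a' b'} → a ≢ b → a' ≢ b' → LeftPreimage a → LeftPreimage b →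
               RightPreimage a' → RightPreimage b' → Σ (List ℕ) λ v → Bispecial d v × w ≡ φ v
    assemble a≢b a'≢b' (v , x , w≡ , lv , fx , a≡) (v₂ , y , w≡₂ , lv₂ , fy , b≡)
                       (v₃ , x' , w≡₃ , lv₃ , fx' , a'≡) (v₄ , y' , w≡₄ , lv₄ , fy' , b'≡) =
      v , ((x , y , (λ x≡y → a≢b (trans a≡ (trans (cong cyc x≡y) (sym b≡)))) ,
             fx , subst (λ u → Factor d (y ∷ u)) (same w≡₂ lv₂) fy) ,
           (x' , y' , (λ x≡y → a'≢b' (trans a'≡ (trans (cong cyc x≡y) (sym b'≡)))) ,
             subst (λ u → Factor d (u ++ x' ∷ [])) (same w≡₃ lv₃) fx' ,
             subst (λ u → Factor d (u ++ y' ∷ [])) (same w≡₄ lv₄) fy')) , w≡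
      where
      same : ∀ {u} → w ≡ φ u → Letters u → u ≡ v
      same {u} w≡u lu = φ-injective u v lu lv (trans (sym w≡u) w≡)

    desubstitute : Σ (List ℕ) λ v → Bispecial d v × w ≡ φ v
    desubstitute =
      let (a , b , a≢b , fa , fb) , (a' , b' , a'≢b' , fa' , fb') = bs in
      assemble a≢b a'≢b' (left-preimage a fa) (left-preimage b fb) (right-preimage a' fa') (right-preimage b' fb')

  classify : ∀ w → Bispecial d w → Σ ℕ λ k → w ≡ W k
  classify w = bounded (length w) w ≤-refl
    where
    bounded : ∀ N w → length w ≤ N → Bispecial d w → Σ ℕ λ k → w ≡ W k
    bounded N       []       _            _  = 0 , refl
    bounded (suc N) (x ∷ w') (s≤s |w'|≤N) bs =
      let v , bv , w≡ = Preimage.desubstitute (x ∷ w') (length w') refl bs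
          |v|≤N = ≤-trans (τʷ-length v)
                    (≤-trans (≤-pred (≤-reflexive (trans (sym (length-φ v)) (cong length (sym w≡))))) |w'|≤N)
          k , v≡ = bounded N v |v|≤N bv
      in suc k , trans w≡ (cong φ v≡)

-- |W_{k+1}| = D_k + |W_k|: W_{k+1} = τ^k(0) W_k and |τ^k(0)| = D_k.
module Lengths (d : ℕ) (2≤d : 2 ≤ d) where
  open Morphism d 2≤d
  open Bispecials d 2≤d using (W)
  open Bonacci d 0<d

  τʷ^ : ℕ → List ℕ → List ℕ
  τʷ^ zero    u = u
  τʷ^ (suc j) u = τʷ (τʷ^ j u)

  τʷ^-++ : ∀ j u v → τʷ^ j (u ++ v) ≡ τʷ^ j u ++ τʷ^ j v
  τʷ^-++ zero    u v = refl
  τʷ^-++ (suc j) u v = trans (cong τʷ (τʷ^-++ j u v)) (τʷ-++ (τʷ^ j u) (τʷ^ j v))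

  τʷ^-τʷ : ∀ j u → τʷ^ j (τʷ u) ≡ τʷ (τʷ^ j u)
  τʷ^-τʷ zero    u = refl
  τʷ^-τʷ (suc j) u = cong τʷ (τʷ^-τʷ j u)

  τʷ^-letter : ∀ j a → τʷ^ (suc j) (a ∷ []) ≡ τʷ^ j (τ d a)
  τʷ^-letter j a = trans (sym (τʷ^-τʷ j (a ∷ []))) (cong (τʷ^ j) (++-identityʳ (τ d a)))

  P-as-iterate : ∀ k → P k ≡ τʷ^ k (0 ∷ [])
  P-as-iterate zero    = refl
  P-as-iterate (suc k) = cong τʷ (P-as-iterate k)

  -- |τ^j(a)| = Σ_{i < d-a} D_{j-i-1}: τ^{j+1}(a) = τ^j(0) τ^j(a+1), or τ^j(0) if a = d-1.
  length-τ^ : ∀ j a → a < d → length (τʷ^ j (a ∷ [])) ≡ σ (Dshift j) (d ∸ a)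
  length-τ^ zero a a<d = sym (trans (cong (σ (Dshift 0)) (+-∸-assoc 1 a<d))
                                    (cong (1 +_) (σ-zero _ (d ∸ suc a) (λ i _ → Dshift-neg 0 i))))
  length-τ^ (suc j) a a<d with shape a
  ... | long a+1<d eq _ = begin
    length (τʷ^ (suc j) (a ∷ []))                       ≡⟨ cong length (τʷ^-letter j a) ⟩
    length (τʷ^ j (τ d a))                              ≡⟨ cong (λ u → length (τʷ^ j u)) eq ⟩
    length (τʷ^ j (0 ∷ suc a ∷ []))                     ≡⟨ cong length (τʷ^-++ j (0 ∷ []) (suc a ∷ [])) ⟩
    length (τʷ^ j (0 ∷ []) ++ τʷ^ j (suc a ∷ []))       ≡⟨ length-++ (τʷ^ j (0 ∷ [])) ⟩
    length (τʷ^ j (0 ∷ [])) + length (τʷ^ j (suc a ∷ []))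
      ≡⟨ cong₂ _+_ (trans (length-τ^ j 0 0<d) (bonacci-sum j)) (length-τ^ j (suc a) a+1<d) ⟩
    Dℕ d j + σ (Dshift j) (d ∸ suc a)
      ≡⟨ cong₂ _+_ (sym (Dshift-0 j)) (σ-cong _ _ (d ∸ suc a) (λ i _ → sym (Dshift-suc j i))) ⟩
    σ (Dshift (suc j)) (suc (d ∸ suc a))                ≡⟨ cong (σ (Dshift (suc j))) (sym (+-∸-assoc 1 a<d)) ⟩
    σ (Dshift (suc j)) (d ∸ a)                          ∎
    where open ≡-Reasoning
  ... | short d≤a+1 eq _ = begin
    length (τʷ^ (suc j) (a ∷ []))   ≡⟨ cong length (trans (τʷ^-letter j a) (cong (τʷ^ j) eq)) ⟩
    length (τʷ^ j (0 ∷ []))         ≡⟨ trans (length-τ^ j 0 0<d) (bonacci-sum j) ⟩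
    Dℕ d j                          ≡⟨ sym (trans (+-identityʳ _) (Dshift-0 j)) ⟩
    σ (Dshift (suc j)) 1            ≡⟨ cong (σ (Dshift (suc j))) (sym d∸a≡1) ⟩
    σ (Dshift (suc j)) (d ∸ a)      ∎
    where open ≡-Reasoning
          d∸a≡1 : d ∸ a ≡ 1
          d∸a≡1 = trans (cong (_∸ a) (sym (top-letter a<d d≤a+1))) (m+n∸n≡m 1 a)

  length-P : ∀ k → length (P k) ≡ Dℕ d k
  length-P k = trans (cong length (P-as-iterate k)) (trans (length-τ^ k 0 0<d) (bonacci-sum k))

  W-suc : ∀ k → W (suc k) ≡ P k ++ W k
  W-suc zero    = refl
  W-suc (suc k) = begin
    τʷ (W (suc k)) ++ 0 ∷ []               ≡⟨ cong (λ u → τʷ u ++ 0 ∷ []) (W-suc k) ⟩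
    τʷ (P k ++ W k) ++ 0 ∷ []              ≡⟨ cong (_++ 0 ∷ []) (τʷ-++ (P k) (W k)) ⟩
    (τʷ (P k) ++ τʷ (W k)) ++ 0 ∷ []       ≡⟨ ++-assoc (τʷ (P k)) (τʷ (W k)) (0 ∷ []) ⟩
    P (suc k) ++ W (suc k)                 ∎
    where open ≡-Reasoning

  length-W-suc : ∀ k → length (W (suc k)) ≡ Dℕ d k + length (W k)
  length-W-suc k = trans (cong length (W-suc k)) (trans (length-++ (P k)) (cong (_+ length (W k)) (length-P k)))

-- B_t(k) = W_k: the bispecial lengths are |W_0| < |W_1| < …, so exactly k of
-- them lie below |W_k|.
module Counting (d : ℕ) (2≤d : 2 ≤ d) where
  open Morphism d 2≤d using (τʷ-length)
  open Bispecials d 2≤d using (W; length-φ; W-bispecial; classify)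

  |W| : ℕ → ℕ
  |W| k = length (W k)

  |W|-increasing : ∀ k → |W| k < |W| (suc k)
  |W|-increasing k = subst (|W| k <_) (sym (length-φ (W k))) (s≤s (τʷ-length (W k)))

  open StrictlyIncreasing |W| |W|-increasing using (monotone; reflect-<)

  W-lengths-↗ : ∀ k → Linked _<_ (applyUpTo |W| k)
  W-lengths-↗ k = applyUpTo⁺₂ |W| k |W|-increasing

  lengths-below : ∀ k ℓ → ℓ < |W| k → BispecialLength d ℓ → ℓ ∈ applyUpTo |W| k
  lengths-below k ℓ ℓ<|Wk| (w , bw , |w|≡ℓ) =
    let i , w≡ = classify w bw
        |Wi|≡ℓ = trans (cong length (sym w≡)) |w|≡ℓ
        i<k = reflect-< {i} {k} (subst (_< |W| k) (sym |Wi|≡ℓ) ℓ<|Wk|)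
    in subst (_∈ applyUpTo |W| k) |Wi|≡ℓ (∈-applyUpTo⁺ |W| i<k)

  W-is-kth : ∀ k → IsKthBispecial d k (W k)
  W-is-kth k = W-bispecial k , applyUpTo |W| k , length-applyUpTo |W| k , W-lengths-↗ k ,
               applyUpTo⁺₁ |W| k (λ {i} i<k → monotone i<k , (W i , W-bispecial i , refl)) , lengths-below k

  -- If W_j is the k-th bispecial factor, its list of shorter bispecial lengths
  -- is |W_0|, …, |W_{j-1}|, so j = k.
  kth-index : ∀ k j → IsKthBispecial d k (W j) → j ≡ k
  kth-index k j (_ , L , |L|≡k , ↗L , L-below , L-complete) =
    trans (sym (length-applyUpTo |W| j)) (trans (cong length (sym L≡)) |L|≡k)
    where
    L≡ : L ≡ applyUpTo |W| j
    L≡ = sorted-≡ L (applyUpTo |W| j) ↗L (W-lengths-↗ j)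
      (λ z z∈L → let z<|Wj| , bz = lookupAll L-below z∈L in lengths-below j z z<|Wj| bz)
      (λ z z∈ → let i , i<j , z≡ = ∈-applyUpTo⁻ |W| z∈
                in subst (_∈ L) (sym z≡) (L-complete (|W| i) (monotone i<j) (W i , W-bispecial i , refl)))

  kth-is-W : ∀ k w → IsKthBispecial d k w → w ≡ W k
  kth-is-W k w kth =
    let j , w≡ = classify w (proj₁ kth)
    in trans w≡ (cong W (kth-index k j (subst (IsKthBispecial d k) w≡ kth)))

lemma18 : (d : ℕ) → 2 ≤ d → (k : ℕ) →
    (∃ λ w → IsKthBispecial d k w) ×
    (∀ w → IsKthBispecial d k w → (d ∸ 1) * length w + d ≡ lenSum d k)
lemma18 d 2≤d k = (W k , W-is-kth k) , length-of-kth
  where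
  open Morphism d 2≤d using (0<d)
  open Bispecials d 2≤d using (W)
  open Lengths d 2≤d using (length-W-suc)
  open Counting d 2≤d using (W-is-kth; kth-is-W)
  open ≡-Reasoning

  length-of-kth : ∀ w → IsKthBispecial d k w → (d ∸ 1) * length w + d ≡ lenSum d k
  length-of-kth w kth = begin
    (d ∸ 1) * length w + d       ≡⟨ cong (λ u → (d ∸ 1) * length u + d) (kth-is-W k w kth) ⟩
    (d ∸ 1) * length (W k) + d   ≡⟨ length-formula d 0<d (λ i → length (W i)) refl length-W-suc k ⟩
    lenSum d k                   ∎
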